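{- Let $n$ and $m$ be positive integers with $5\le n\le 2m+1$. Suppose $\sigma\in S_n$ has disjoint cycle decomposition $C_1\cdots C_r$ (each fixed point counted as a $1$-cycle). Suppose $s$ of the cycles $C_i$ belong to $L_m$, and among these there are $t$ pairwise disjoint pairs $\{C_i,C_j\}$ each satisfying the following condition: writing $C_i=(i_1,\dots,i_p)$ and $C_j=(j_1,\dots,j_q)$, there exist $1\le r\le p$ and $1\le s'\le q$ with $|i_k-j_{s'}|\le m$ for all $k=1,\dots,p$ and $|j_u-i_r|\le m$ for all $u=1,\dots,q$. Then $d({\bf 1},\sigma,m)\le n-r+2s-2t$.
   Context: $S_n$ is the symmetric group on $\{1,\dots,n\}$ with products being compositions. $G_m$ is the set of transpositions $(a,b)\in S_n$ with $1\le a<b\le n$ and $b-a\le m$, and $d({\bf 1},\sigma,m)$ is the minimum number of transpositions from $G_m$ whose product is $\sigma$. A cycle $C=(i_1,\dots,i_p)$ belongs to $L_m$ if for each term $i_u$ of $C$ there is a term $i_v$ of $C$ with $|i_u-i_v|>m$. -}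

module Defs where

open import Data.Nat using (ℕ; zero; suc; _+_; _*_; _∸_; _≤_; _<_; _<?_; ∣_-_∣)
open import Data.Fin using (Fin; toℕ)
open import Data.Fin.Permutation using (Permutation′; _⟨$⟩ʳ_; _∘ₚ_; id; transpose)
open import Data.List using (List; []; _∷_; length; foldr; concat; concatMap; filter; lookup; allFin)
open import Data.List.Relation.Unary.All using (All; all?)
open import Data.List.Relation.Unary.Any using (Any; any?)
open import Data.List.Relation.Unary.Unique.Propositional using (Unique)
open import Data.List.Relation.Binary.Permutation.Propositional using (_↭_)
open import Data.Product using (Σ; _×_; _,_; ∃)
open import Relation.Binary.PropositionalEquality using (_≡_)
open import Relation.Unary using (Decidable)
open import Data.Empty using (⊥)

-- S_n : permutations of Fin n (Fin n plays the role of {1,...,n})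
S : ℕ → Set
S n = Permutation′ n

dist : ∀ {n} → Fin n → Fin n → ℕ
dist a b = ∣ toℕ a - toℕ b ∣

InG : ∀ {n} → ℕ → Fin n × Fin n → Set
InG m (a , b) = (toℕ a < toℕ b) × (toℕ b ∸ toℕ a ≤ m)

prod : ∀ {n} → List (Fin n × Fin n) → S n
prod []             = id
prod ((a , b) ∷ ws) = transpose a b ∘ₚ prod ws

_IsProductOf_ : ∀ {n} → S n → List (Fin n × Fin n) → Set
σ IsProductOf ws = ∀ x → prod ws ⟨$⟩ʳ x ≡ σ ⟨$⟩ʳ x

-- d(1, σ, m) ≤ K : σ is a product of at most K transpositions from G_m
-- (d is the minimum such number, so this is exactly "d ≤ K")
d≤ : ∀ {n} → S n → ℕ → ℕ → Set
d≤ {n} σ m K = Σ (List (Fin n × Fin n)) λ ws →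
  All (InG m) ws × (length ws ≤ K) × (σ IsProductOf ws)

-- the list (i₁ , ... , i_p) is a cycle of σ : σ i_k = i_{k+1} and σ i_p = i₁
Steps : ∀ {n} → S n → Fin n → Fin n → List (Fin n) → Set
Steps σ first a []       = σ ⟨$⟩ʳ a ≡ first
Steps σ first a (b ∷ cs) = (σ ⟨$⟩ʳ a ≡ b) × Steps σ first b cs

IsCycleOf : ∀ {n} → S n → List (Fin n) → Set
IsCycleOf σ []       = ⊥
IsCycleOf σ (a ∷ cs) = Steps σ a a cs

-- cs = C₁ ⋯ C_r is the disjoint cycle decomposition of σ (fixed points as 1-cycles):
-- every C_i is a cycle of σ, and the terms of all cycles together are exactly
-- 1..n, each occurring exactly once
IsCycleDecomposition : ∀ {n} → S n → List (List (Fin n)) → Set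
IsCycleDecomposition {n} σ cs = All (IsCycleOf σ) cs × (concat cs ↭ allFin n)

InL : ∀ {n} → ℕ → List (Fin n) → Set
InL m c = All (λ x → Any (λ y → m < dist x y) c) c

InL? : ∀ {n} (m : ℕ) → Decidable (InL {n} m)
InL? m c = all? (λ x → any? (λ y → m <? dist x y) c) c

countL : ∀ {n} → ℕ → List (List (Fin n)) → ℕ
countL m cs = length (filter (InL? m) cs)

PairCond : ∀ {n} → ℕ → List (Fin n) → List (Fin n) → Set
PairCond m ci cj =
  Any (λ y → All (λ x → dist x y ≤ m) ci) cj ×
  Any (λ x → All (λ y → dist y x ≤ m) cj) ci

-- a family of pairs {C_i , C_j} (given by indices) of L_m-cycles satisfying
-- PairCond, pairwise disjoint (all 2t indices distinct)
GoodPairs : ∀ {n} → ℕ → (cs : List (List (Fin n))) → List (Fin (length cs) × Fin (length cs)) → Set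
GoodPairs m cs ps =
  All (λ { (i , j) → InL m (lookup cs i) × InL m (lookup cs j) × PairCond m (lookup cs i) (lookup cs j) }) ps ×
  Unique (concatMap (λ { (i , j) → i ∷ j ∷ [] }) ps)

-- A cycle C whose points all lie within m of one of them, c, is the product of the
-- |C| - 1 transpositions (c x), x ∈ C, x ≠ c, all in G_m.  A cycle in L_m has no such
-- point, but as n ≤ 2m + 1 the midpoint z = m + 1 is within m of every point and lies
-- outside C; for C = (a …) the star (z a …) followed by (z a) is C, at a cost of
-- |C| + 1 generators.  For a pair {Ci, Cj} as in the statement, with x ∈ Ci near
-- all of Cj and y ∈ Cj near all of Ci, the stars at y and at x produce Ci Cj with
-- |Ci| + |Cj| generators, two fewer than the two cycles separately.  Words for disjoint
-- σ-invariant sets concatenate, so σ is a product of at most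
-- Σ (|C| - 1) + 2s - 2t = n - r + 2s - 2t generators.

module Submission where

open import Defs
open import Data.Empty using (⊥-elim)
open import Data.Fin using (Fin; toℕ; fromℕ<)
open import Data.Fin.Properties using (_≟_; toℕ<n; toℕ-injective; toℕ-fromℕ<)
open import Data.Fin.Permutation using (_⟨$⟩ʳ_; _⟨$⟩ˡ_; transpose; inverseˡ)
open import Data.List using (List; []; _∷_; _++_; _∷ʳ_; length; map; concat; concatMap; lookup; allFin)
open import Data.List.Properties
  using (length-++; length-map; length-tabulate; map-++; ++-assoc; concat-++; map-tabulate; tabulate-lookup)
open import Data.List.Membership.Propositional using (_∈_; _∉_; find)
open import Data.List.Membership.Propositional.Properties using (∈-++⁺ˡ; ∈-++⁺ʳ; ∈-++⁻; ∈-∃++; ∈-allFin)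
open import Data.List.Relation.Unary.All as All using (All; []; _∷_)
open import Data.List.Relation.Unary.All.Properties using (¬All⇒Any¬; ¬Any⇒All¬; All¬⇒¬Any)
  renaming (++⁺ to All-++⁺; ++⁻ to All-++⁻; map⁺ to All-map⁺)
open import Data.List.Relation.Unary.AllPairs as AllPairs using ([]; _∷_)
open import Data.List.Relation.Unary.Any using (here; there; any?)
open import Data.List.Relation.Unary.Unique.Propositional using (Unique)
open import Data.List.Relation.Unary.Unique.Propositional.Properties using (allFin⁺)
open import Data.List.Relation.Binary.Disjoint.Propositional using (Disjoint)
open import Data.List.Relation.Binary.Permutation.Propositional
  using (_↭_; ↭-refl; ↭-reflexive; ↭-sym; ↭-trans; prep; ↭⇒↭ₛ; module PermutationReasoning)
open import Data.List.Relation.Binary.Permutation.Propositional.Properties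
  using (All-resp-↭; ∈-resp-↭; ↭-length; ++⁺; ++-comm; shift; ∷↭∷ʳ) renaming (map⁺ to map-↭)
import Data.List.Relation.Binary.Permutation.Setoid.Properties as Permₛ
open import Data.List.Relation.Binary.BagAndSetEquality using (↭⇒∼bag; ∼bag⇒↭; concat-cong)
open import Data.Nat using (ℕ; suc; z≤n; pred; _+_; _*_; _∸_; _≤_; _<_; _<?_)
open import Data.Nat.ListAction using (sum)
open import Data.Nat.ListAction.Properties using (sum-++; sum-↭)
open import Data.Nat.Properties
  using (≤-reflexive; ≤-trans; <-trans; ≤-<-trans; <⇒≤; <⇒≱; ≮⇒≥; ≤∧≢⇒<; m<1+n⇒m≤n; suc-injective;
         +-comm; +-assoc; +-identityʳ; +-mono-≤; +-monoˡ-≤; ⊔-lub; m∸n≤m; m+n∸n≡m; m≤n+m∸n;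
         m≤n+o⇒m∸n≤o; m+n≤o⇒m≤o∸n; ∣-∣-comm; ∣m-n∣≤m⊔n; ∣m-n∣≡[m∸n]∨[n∸m];
         m≤n⇒∣m-n∣≡n∸m; m≤n⇒∣n-m∣≡n∸m; module ≤-Reasoning)
open import Data.Nat.Tactic.RingSolver using (solve-∀)
open import Data.Product using (∃-syntax; _×_; _,_; proj₁; proj₂; map₁) renaming (map to ×-map)
open import Data.Sum using (inj₁; inj₂)
open import Data.Bool using (true; false; if_then_else_)
open import Function using (_∘_)
open import Relation.Nullary using (¬_; yes; no; does)
open import Relation.Nullary.Decidable using (dec-true; dec-false)
open import Relation.Binary.PropositionalEquality
  using (_≡_; _≢_; refl; sym; trans; cong; cong₂; subst; ≢-sym; setoid; module ≡-Reasoning)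

private
  variable
    n m : ℕ
    A : Set

Unique-resp-↭ : {xs ys : List A} → xs ↭ ys → Unique xs → Unique ys
Unique-resp-↭ p = Permₛ.Unique-resp-↭ (setoid _) (↭⇒↭ₛ p)

Unique-++⁻ : ∀ (xs : List A) {ys} → Unique (xs ++ ys) → Unique xs × Unique ys × Disjoint xs ys
Unique-++⁻ []       u = [] , u , λ ()
Unique-++⁻ (x ∷ xs) (x∉ ∷ u) with Unique-++⁻ xs u | All-++⁻ xs x∉
... | uxs , uys , disj | x∉xs , x∉ys = x∉xs ∷ uxs , uys , λ
  { (here refl , x∈ys) → All¬⇒¬Any x∉ys x∈ys
  ; (there v∈xs , v∈ys) → disj (v∈xs , v∈ys)
  }

∃-↭-complement : ∀ {xs ys : List A} → Unique xs → (∀ {x} → x ∈ xs → x ∈ ys) → ∃[ zs ] xs ++ zs ↭ ys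
∃-↭-complement {xs = []}     {ys} _ _ = ys , ↭-refl
∃-↭-complement {xs = x ∷ xs} (x∉xs ∷ u) xs⊆ys with ∈-∃++ (xs⊆ys (here refl))
... | ys₁ , ys₂ , refl with ∃-↭-complement u xs⊆ys₁++ys₂
  where
  xs⊆ys₁++ys₂ : ∀ {y} → y ∈ xs → y ∈ ys₁ ++ ys₂
  xs⊆ys₁++ys₂ y∈xs with ∈-resp-↭ (shift x ys₁ ys₂) (xs⊆ys (there y∈xs))
  ... | here refl = ⊥-elim (All¬⇒¬Any x∉xs y∈xs)
  ... | there y∈  = y∈
... | zs , xs++zs↭ = zs , ↭-trans (prep x xs++zs↭) (↭-sym (shift x ys₁ ys₂))

concat-↭ : {xss yss : List (List A)} → xss ↭ yss → concat xss ↭ concat yss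
concat-↭ p = ∼bag⇒↭ (concat-cong (↭⇒∼bag p))

flatten : List (A × A) → List A
flatten = concatMap λ (a , b) → a ∷ b ∷ []

flatten-map : ∀ {B : Set} (f : A → B) ps → map f (flatten ps) ≡ flatten (map (×-map f f) ps)
flatten-map f []             = refl
flatten-map f ((a , b) ∷ ps) = cong (λ l → f a ∷ f b ∷ l) (flatten-map f ps)

-- Words of transpositions

Word : ℕ → Set
Word n = List (Fin n × Fin n)

τ : Fin n × Fin n → Fin n → Fin n
τ (a , b) = transpose a b ⟨$⟩ʳ_

-- Words act left to right: the first letter is applied first.
act : Word n → Fin n → Fin n
act w = prod w ⟨$⟩ʳ_

act-++ : ∀ (w v : Word n) x → act (w ++ v) x ≡ act v (act w x)
act-++ []      v x = refl
act-++ (t ∷ w) v x = act-++ w v (τ t x)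

act-injective : ∀ (w : Word n) {x y} → act w x ≡ act w y → x ≡ y
act-injective w {x} {y} eq = begin
  x                   ≡⟨ inverseˡ (prod w) ⟨
  prod w ⟨$⟩ˡ act w x ≡⟨ cong (prod w ⟨$⟩ˡ_) eq ⟩
  prod w ⟨$⟩ˡ act w y ≡⟨ inverseˡ (prod w) ⟩
  y                   ∎
  where open ≡-Reasoning

τ-left : ∀ (i j : Fin n) → τ (i , j) i ≡ j
τ-left i j with i ≟ i
... | yes _   = refl
... | no  i≢i = ⊥-elim (i≢i refl)

τ-right : ∀ (i j : Fin n) → τ (i , j) j ≡ i
τ-right i j with j ≟ i
... | yes j≡i = j≡i
... | no  _ with j ≟ j
...   | yes _   = refl
...   | no  j≢j = ⊥-elim (j≢j refl)

τ-fix : ∀ {i j k : Fin n} → k ≢ i → k ≢ j → τ (i , j) k ≡ k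
τ-fix {i = i} {j} {k} k≢i k≢j with k ≟ i
... | yes k≡i = ⊥-elim (k≢i k≡i)
... | no  _ with k ≟ j
...   | yes k≡j = ⊥-elim (k≢j k≡j)
...   | no  _   = refl

-- The transposition of c and x, with its entries ordered as G_m requires.
edge : Fin n → Fin n → Fin n × Fin n
edge c x with toℕ c <? toℕ x
... | yes _ = c , x
... | no  _ = x , c

edge-left : ∀ (c x : Fin n) → τ (edge c x) c ≡ x
edge-left c x with toℕ c <? toℕ x
... | yes _ = τ-left c x
... | no  _ = τ-right x c

edge-right : ∀ (c x : Fin n) → τ (edge c x) x ≡ c
edge-right c x with toℕ c <? toℕ x
... | yes _ = τ-right c x
... | no  _ = τ-left x c

edge-fix : ∀ {c x k : Fin n} → k ≢ c → k ≢ x → τ (edge c x) k ≡ k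
edge-fix {c = c} {x} k≢c k≢x with toℕ c <? toℕ x
... | yes _ = τ-fix k≢c k≢x
... | no  _ = τ-fix k≢x k≢c

edge-InG : ∀ {c x : Fin n} → c ≢ x → dist c x ≤ m → InG m (edge c x)
edge-InG {c = c} {x} c≢x c~x with toℕ c <? toℕ x
... | yes c<x = c<x , subst (_≤ _) (m≤n⇒∣m-n∣≡n∸m (<⇒≤ c<x)) c~x
... | no  c≮x = x<c , subst (_≤ _) (m≤n⇒∣n-m∣≡n∸m (<⇒≤ x<c)) c~x
  where
  x<c : toℕ x < toℕ c
  x<c = ≤∧≢⇒< (≮⇒≥ c≮x) (c≢x ∘ sym ∘ toℕ-injective)

Steps-transfer : ∀ {π ρ : S n} {f a a′} cs → (∀ {y} → y ∈ cs → π ⟨$⟩ʳ y ≡ ρ ⟨$⟩ʳ y) →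
                 π ⟨$⟩ʳ a′ ≡ ρ ⟨$⟩ʳ a → Steps ρ f a cs → Steps π f a′ cs
Steps-transfer []       _     eq ρa≡f          = trans eq ρa≡f
Steps-transfer (b ∷ cs) π≗ρ eq (ρa≡b , steps) =
  trans eq ρa≡b , Steps-transfer cs (π≗ρ ∘ there) (π≗ρ (here refl)) steps

Steps-then : ∀ (w v : Word n) {f f′ a} cs → (∀ {y} → y ∈ cs → act v y ≡ y) → act v f ≡ f′ →
             Steps (prod w) f a cs → Steps (prod (w ++ v)) f′ a cs
Steps-then w v {a = a} []       _     vf≡f′ wa≡f =
  trans (act-++ w v a) (trans (cong (act v) wa≡f) vf≡f′)
Steps-then w v {a = a} (b ∷ cs) v-fix vf≡f′ (wa≡b , steps) =
  trans (act-++ w v a) (trans (cong (act v) wa≡b) (v-fix (here refl))) ,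
  Steps-then w v cs (v-fix ∘ there) vf≡f′ steps

Steps-++⁻ : ∀ {π : S n} {f a b} xs ys → Steps π f a (xs ++ b ∷ ys) → Steps π b a xs × Steps π f b ys
Steps-++⁻ []       ys (πa≡b , steps) = πa≡b , steps
Steps-++⁻ (x ∷ xs) ys (πa≡x , steps) = map₁ (πa≡x ,_) (Steps-++⁻ xs ys steps)

Steps-++⁺ : ∀ {π : S n} {f a b} xs ys → Steps π b a xs → Steps π f b ys → Steps π f a (xs ++ b ∷ ys)
Steps-++⁺ []       ys πa≡b            steps = πa≡b , steps
Steps-++⁺ (x ∷ xs) ys (πa≡x , steps₁) steps = πa≡x , Steps-++⁺ xs ys steps₁ steps

Steps-agree : ∀ {π ρ : S n} {f a} cs → Steps π f a cs → Steps ρ f a cs →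
              ∀ {y} → y ∈ a ∷ cs → π ⟨$⟩ʳ y ≡ ρ ⟨$⟩ʳ y
Steps-agree []       πa≡f       ρa≡f       (here refl) = trans πa≡f (sym ρa≡f)
Steps-agree (b ∷ cs) (πa≡b , _) (ρa≡b , _) (here refl) = trans πa≡b (sym ρa≡b)
Steps-agree (b ∷ cs) (_ , πs)   (_ , ρs)   (there y∈)  = Steps-agree cs πs ρs y∈

cycle-rotate : ∀ {π : S n} {a c} cs → IsCycleOf π (a ∷ cs) → c ∈ a ∷ cs →
               ∃[ xs ] IsCycleOf π (c ∷ xs) × c ∷ xs ↭ a ∷ cs
cycle-rotate cs cycle (here refl) = cs , cycle , ↭-refl
cycle-rotate cs cycle (there c∈cs) with ∈-∃++ c∈cs
... | ys , zs , refl with Steps-++⁻ ys zs cycle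
...   | a↝c , c↝a = zs ++ _ ∷ ys , Steps-++⁺ zs ys c↝a a↝c , ++-comm (_ ∷ zs) (_ ∷ ys)

-- Stars

star : Fin n → List (Fin n) → Word n
star c = map (edge c)

star-fixes : ∀ {c y : Fin n} xs → y ∉ c ∷ xs → act (star c xs) y ≡ y
star-fixes []       _   = refl
star-fixes {c = c} (x ∷ xs) y∉ = trans
  (cong (act (star c xs)) (edge-fix (y∉ ∘ here) (y∉ ∘ there ∘ here)))
  (star-fixes xs λ { (here y≡c) → y∉ (here y≡c) ; (there y∈xs) → y∉ (there (there y∈xs)) })

star-cycle : ∀ {c : Fin n} xs → Unique (c ∷ xs) → IsCycleOf (prod (star c xs)) (c ∷ xs)
star-cycle []       _ = refl
star-cycle {c = c} (x ∷ xs) ((c≢x ∷ c∉xs) ∷ x∉xs ∷ u) =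
  trans (cong (act (star c xs)) (edge-left c x))
        (star-fixes xs λ { (here x≡c) → c≢x (sym x≡c) ; (there x∈xs) → All¬⇒¬Any x∉xs x∈xs }) ,
  Steps-transfer xs
    (λ y∈xs → cong (act (star c xs))
                   (edge-fix (≢-sym (All.lookup c∉xs y∈xs)) (≢-sym (All.lookup x∉xs y∈xs))))
    (cong (act (star c xs)) (edge-right c x))
    (star-cycle xs (c∉xs ∷ u))

dist-comm : ∀ (x y : Fin n) → dist x y ≡ dist y x
dist-comm x y = ∣-∣-comm (toℕ x) (toℕ y)

star-InG : ∀ {c : Fin n} {xs} → c ∉ xs → All (λ x → dist x c ≤ m) xs → All (InG m) (star c xs)
star-InG {c = c} c∉xs near = All-map⁺ (All.tabulate λ {x} x∈xs →
  edge-InG {c = c} (λ { refl → c∉xs x∈xs }) (subst (_≤ _) (dist-comm x c) (All.lookup near x∈xs)))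

-- The cycles (y x xs) and (x ys y), applied in turn, multiply to (x xs)(y ys).
linked : Fin n → List (Fin n) → Fin n → List (Fin n) → Word n
linked x xs y ys = star y (x ∷ xs) ++ star x (ys ∷ʳ y)

linked-length : ∀ (x : Fin n) xs y ys → length (linked x xs y ys) ≡ length (x ∷ xs) + length (y ∷ ys)
linked-length x xs y ys = begin
  length (star y (x ∷ xs) ++ star x (ys ∷ʳ y))
    ≡⟨ length-++ (star y (x ∷ xs)) ⟩
  length (star y (x ∷ xs)) + length (star x (ys ∷ʳ y))
    ≡⟨ cong₂ _+_ (length-map _ (x ∷ xs)) (length-map _ (ys ∷ʳ y)) ⟩
  length (x ∷ xs) + length (ys ∷ʳ y)
    ≡⟨ cong (length (x ∷ xs) +_) (↭-length (↭-sym (∷↭∷ʳ y ys))) ⟩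
  length (x ∷ xs) + length (y ∷ ys) ∎
  where open ≡-Reasoning

linked-fixes : ∀ {x y z : Fin n} xs ys → z ∉ x ∷ xs → z ∉ y ∷ ys → act (linked x xs y ys) z ≡ z
linked-fixes {x = x} {y} {z} xs ys z∉Ci z∉Cj = begin
  act (star y (x ∷ xs) ++ star x (ys ∷ʳ y)) z ≡⟨ act-++ (star y (x ∷ xs)) _ z ⟩
  act (star x (ys ∷ʳ y)) (act (star y (x ∷ xs)) z) ≡⟨ cong (act (star x (ys ∷ʳ y))) (star-fixes (x ∷ xs) λ
     { (here z≡y) → z∉Cj (here z≡y) ; (there z∈Ci) → z∉Ci z∈Ci }) ⟩
  act (star x (ys ∷ʳ y)) z ≡⟨ star-fixes (ys ∷ʳ y) (λ
     { (here z≡x) → z∉Ci (here z≡x) ; (there z∈) → z∉Cj (∈-resp-↭ (↭-sym (∷↭∷ʳ y ys)) z∈) }) ⟩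
  z ∎
  where open ≡-Reasoning

linked-cycles : ∀ {x y : Fin n} xs ys → Unique (x ∷ xs) → Unique (y ∷ ys) → Disjoint (x ∷ xs) (y ∷ ys) →
                IsCycleOf (prod (linked x xs y ys)) (x ∷ xs) × IsCycleOf (prod (linked x xs y ys)) (y ∷ ys)
linked-cycles {x = x} {y} xs ys ux@(x∉xs ∷ _) uy@(y∉ys ∷ _) disj =
  Steps-then h g xs g-fixes (proj₂ g-cycle-split) (proj₂ h-cycle) ,
  Steps-transfer ys (λ {v} v∈ys → trans (act-++ h g v) (cong (act g) (h-fixes v∈ys)))
                    (trans (act-++ h g y) (cong (act g) (proj₁ h-cycle)))
                    (proj₁ g-cycle-split)
  where
  h = star y (x ∷ xs)
  g = star x (ys ∷ʳ y)
  ys∷ʳy↭ : ys ∷ʳ y ↭ y ∷ ys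
  ys∷ʳy↭ = ↭-sym (∷↭∷ʳ y ys)
  h-cycle : IsCycleOf (prod h) (y ∷ x ∷ xs)
  h-cycle = star-cycle (x ∷ xs) (¬Any⇒All¬ _ (λ y∈Ci → disj (y∈Ci , here refl)) ∷ ux)
  g-cycle-split : Steps (prod g) y x ys × Steps (prod g) x y []
  g-cycle-split = Steps-++⁻ ys [] (star-cycle (ys ∷ʳ y)
    (¬Any⇒All¬ _ (λ x∈ → disj (here refl , ∈-resp-↭ ys∷ʳy↭ x∈)) ∷ Unique-resp-↭ (∷↭∷ʳ y ys) uy))
  g-fixes : ∀ {v} → v ∈ xs → act g v ≡ v
  g-fixes v∈xs = star-fixes (ys ∷ʳ y) λ
    { (here v≡x) → All.lookup x∉xs v∈xs (sym v≡x)
    ; (there v∈) → disj (there v∈xs , ∈-resp-↭ ys∷ʳy↭ v∈) }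
  h-fixes : ∀ {v} → v ∈ ys → act h v ≡ v
  h-fixes v∈ys = star-fixes (x ∷ xs) λ
    { (here v≡y) → All.lookup y∉ys v∈ys (sym v≡y)
    ; (there v∈Ci) → disj (v∈Ci , there v∈ys) }

-- Factorisations of σ on invariant pieces

record Factorisation (σ : S n) (m : ℕ) (X : List (Fin n)) (b : ℕ) : Set where
  field
    word     : Word n
    word-InG : All (InG m) word
    length≤  : length word ≤ b
    agrees   : ∀ {x} → x ∈ X → act word x ≡ σ ⟨$⟩ʳ x
    fixes    : ∀ {x} → x ∉ X → act word x ≡ x

module _ {σ : S n} where

  Factorisation-[] : Factorisation σ m [] 0
  Factorisation-[] = record
    { word = [] ; word-InG = [] ; length≤ = z≤n ; agrees = λ () ; fixes = λ _ → refl }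

  Factorisation-resp-↭ : ∀ {X Y b} → X ↭ Y → Factorisation σ m X b → Factorisation σ m Y b
  Factorisation-resp-↭ X↭Y F = record
    { word = word ; word-InG = word-InG ; length≤ = length≤
    ; agrees = agrees ∘ ∈-resp-↭ (↭-sym X↭Y)
    ; fixes = λ x∉Y → fixes (x∉Y ∘ ∈-resp-↭ X↭Y) }
    where open Factorisation F

  Factorisation-++ : ∀ {X Y b c} → Disjoint X Y →
                     Factorisation σ m X b → Factorisation σ m Y c → Factorisation σ m (X ++ Y) (b + c)
  Factorisation-++ {X = X} {Y} disj F G = record
    { word = F.word ++ G.word
    ; word-InG = All-++⁺ F.word-InG G.word-InG
    ; length≤ = subst (_≤ _) (sym (length-++ F.word)) (+-mono-≤ F.length≤ G.length≤)
    ; agrees = agrees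
    ; fixes = λ {x} x∉ → trans (act-++ F.word G.word x)
        (trans (cong (act G.word) (F.fixes (x∉ ∘ ∈-++⁺ˡ))) (G.fixes (x∉ ∘ ∈-++⁺ʳ X)))
    }
    where
    module F = Factorisation F
    module G = Factorisation G
    -- σ x ∈ Y would make F.word fix σ x, so σ x = x by injectivity, and x ∈ X ∩ Y.
    σ-leaves-X : ∀ {x} → x ∈ X → σ ⟨$⟩ʳ x ∉ Y
    σ-leaves-X x∈X σx∈Y = disj (x∈X , subst (_∈ Y)
      (act-injective F.word (trans (F.fixes λ σx∈X → disj (σx∈X , σx∈Y)) (sym (F.agrees x∈X)))) σx∈Y)
    agrees : ∀ {x} → x ∈ X ++ Y → act (F.word ++ G.word) x ≡ σ ⟨$⟩ʳ x
    agrees {x} x∈ with ∈-++⁻ X x∈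
    ... | inj₁ x∈X = trans (act-++ F.word G.word x)
      (trans (cong (act G.word) (F.agrees x∈X)) (G.fixes (σ-leaves-X x∈X)))
    ... | inj₂ x∈Y = trans (act-++ F.word G.word x)
      (trans (cong (act G.word) (F.fixes λ x∈X → disj (x∈X , x∈Y))) (G.agrees x∈Y))

  Factorisation⇒d≤ : ∀ {X b K} → (∀ x → x ∈ X) → Factorisation σ m X b → b ≤ K → d≤ σ m K
  Factorisation⇒d≤ covers F b≤K = word , word-InG , ≤-trans length≤ b≤K , agrees ∘ covers
    where open Factorisation F

  centre-factorisation : ∀ {a c} cs → IsCycleOf σ (a ∷ cs) → Unique (a ∷ cs) → c ∈ a ∷ cs →
                         All (λ x → dist x c ≤ m) (a ∷ cs) → Factorisation σ m (a ∷ cs) (length cs)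
  centre-factorisation {c = c} cs cycle u c∈ near with cycle-rotate cs cycle c∈
  ... | xs , cycle′ , c∷xs↭ = Factorisation-resp-↭ c∷xs↭ (record
    { word = star c xs
    ; word-InG = star-InG (All¬⇒¬Any c∉xs) (All.tail (All-resp-↭ (↭-sym c∷xs↭) near))
    ; length≤ = ≤-reflexive (trans (length-map _ xs) (suc-injective (↭-length c∷xs↭)))
    ; agrees = Steps-agree xs (star-cycle xs u′) cycle′
    ; fixes = star-fixes xs
    })
    where
    u′ : Unique (c ∷ xs)
    u′ = Unique-resp-↭ (↭-sym c∷xs↭) u
    c∉xs = AllPairs.head u′

  outer-centre-factorisation : ∀ {a z} cs → IsCycleOf σ (a ∷ cs) → Unique (a ∷ cs) → z ∉ a ∷ cs →
                               All (λ x → dist x z ≤ m) (a ∷ cs) → Factorisation σ m (a ∷ cs) (2 + length cs)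
  outer-centre-factorisation {a = a} {z} cs cycle u z∉ near = record
    { word = linked a cs z []
    ; word-InG = All-++⁺ (star-InG z∉ near)
                         (star-InG (λ { (here a≡z) → z∉ (here (sym a≡z)) })
                                   (subst (_≤ _) (dist-comm a z) (All.head near) ∷ []))
    ; length≤ = ≤-reflexive (trans (linked-length a cs z []) (+-comm (length (a ∷ cs)) 1))
    ; agrees = Steps-agree cs (proj₁ cycles) cycle
    ; fixes = fixes
    }
    where
    cycles = linked-cycles cs [] u ([] ∷ []) λ { (v∈ , here refl) → z∉ v∈ }
    fixes : ∀ {x} → x ∉ a ∷ cs → act (linked a cs z []) x ≡ x
    fixes {x} x∉ with x ≟ z
    ... | yes refl = proj₂ cycles
    ... | no  x≢z  = linked-fixes cs [] x∉ λ { (here x≡z) → x≢z x≡z }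

  pair-factorisation : ∀ {Ci Cj} → IsCycleOf σ Ci → IsCycleOf σ Cj → Unique Ci → Unique Cj → Disjoint Ci Cj →
                       PairCond m Ci Cj → Factorisation σ m (Ci ++ Cj) (length Ci + length Cj)
  pair-factorisation {Ci = a ∷ as} {b ∷ bs} cycleᵢ cycleⱼ uᵢ uⱼ disj (nearᵢ , nearⱼ)
    with find nearᵢ | find nearⱼ
  ... | y , y∈Cj , Ci~y | x , x∈Ci , Cj~x
    with cycle-rotate as cycleᵢ x∈Ci | cycle-rotate bs cycleⱼ y∈Cj
  ... | xs , cycleₓ , pᵢ | ys , cycleᵧ , pⱼ = Factorisation-resp-↭ (++⁺ pᵢ pⱼ) (record
    { word = linked x xs y ys
    ; word-InG = All-++⁺
        (star-InG (λ y∈ → disj′ (y∈ , here refl)) (All-resp-↭ (↭-sym pᵢ) Ci~y))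
        (star-InG (λ x∈ → disj′ (here refl , ∈-resp-↭ (↭-sym (∷↭∷ʳ y ys)) x∈))
                  (All-resp-↭ (↭-trans (↭-sym pⱼ) (∷↭∷ʳ y ys)) Cj~x))
    ; length≤ = ≤-reflexive (trans (linked-length x xs y ys) (cong₂ _+_ (↭-length pᵢ) (↭-length pⱼ)))
    ; agrees = agrees
    ; fixes = λ v∉ → linked-fixes xs ys (v∉ ∘ ∈-++⁺ˡ) (v∉ ∘ ∈-++⁺ʳ (x ∷ xs))
    })
    where
    disj′ : Disjoint (x ∷ xs) (y ∷ ys)
    disj′ (v∈ᵢ , v∈ⱼ) = disj (∈-resp-↭ pᵢ v∈ᵢ , ∈-resp-↭ pⱼ v∈ⱼ)
    cycles = linked-cycles xs ys (Unique-resp-↭ (↭-sym pᵢ) uᵢ) (Unique-resp-↭ (↭-sym pⱼ) uⱼ) disj′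
    agrees : ∀ {v} → v ∈ (x ∷ xs) ++ (y ∷ ys) → act (linked x xs y ys) v ≡ σ ⟨$⟩ʳ v
    agrees v∈ with ∈-++⁻ (x ∷ xs) v∈
    ... | inj₁ v∈ᵢ = Steps-agree xs (proj₁ cycles) cycleₓ v∈ᵢ
    ... | inj₂ v∈ⱼ = Steps-agree ys (proj₂ cycles) cycleᵧ v∈ⱼ

-- Cycles in and out of L_m

dist<n : ∀ (x y : Fin n) → dist x y < n
dist<n x y = ≤-<-trans (∣m-n∣≤m⊔n (toℕ x) (toℕ y)) (⊔-lub (toℕ<n x) (toℕ<n y))

InL⇒m<n : ∀ {a : Fin n} {cs} → InL m (a ∷ cs) → m < n
InL⇒m<n {a = a} inL with find (All.head inL)
... | y , _ , m<a~y = <-trans m<a~y (dist<n a y)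

midpoint-near : n ≤ 2 * m + 1 → (m<n : m < n) → ∀ x → dist x (fromℕ< m<n) ≤ m
midpoint-near {n} {m} n≤2m+1 m<n x rewrite toℕ-fromℕ< m<n with ∣m-n∣≡[m∸n]∨[n∸m] (toℕ x) m
... | inj₁ eq = subst (_≤ m) (sym eq) (m≤n+o⇒m∸n≤o (toℕ x) m x≤m+m)
  where
  2m+1≡1+m+m : 2 * m + 1 ≡ suc (m + m)
  2m+1≡1+m+m = trans (+-comm (2 * m) 1) (cong (λ k → suc (m + k)) (+-identityʳ m))
  x≤m+m : toℕ x ≤ m + m
  x≤m+m = m<1+n⇒m≤n (≤-trans (toℕ<n x) (subst (n ≤_) 2m+1≡1+m+m n≤2m+1))
... | inj₂ eq = subst (_≤ m) (sym eq) (m∸n≤m m (toℕ x))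

near-all⇒∉InL : ∀ {z : Fin n} {C} → (∀ x → dist x z ≤ m) → InL m C → z ∉ C
near-all⇒∉InL {z = z} near inL z∈C with find (All.lookup inL z∈C)
... | y , _ , m<z~y = <⇒≱ m<z~y (subst (_≤ _) (dist-comm y z) (near y))

¬InL⇒centre : ∀ {C : List (Fin n)} → ¬ InL m C → ∃[ c ] c ∈ C × All (λ x → dist x c ≤ m) C
¬InL⇒centre {m = m} {C} ¬inL with find (¬All⇒Any¬ (λ x → any? (λ y → m <? dist x y) C) C ¬inL)
... | c , c∈C , ¬far =
  c , c∈C , All.map (λ {x} c≁x → subst (_≤ m) (dist-comm c x) (≮⇒≥ c≁x)) (¬Any⇒All¬ C ¬far)

cost : ℕ → List (Fin n) → ℕ
cost m C = (if does (InL? m C) then 2 else 0) + pred (length C)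

cost-InL : ∀ {a : Fin n} cs → InL m (a ∷ cs) → cost m (a ∷ cs) ≡ 2 + length cs
cost-InL {m = m} {a} cs inL rewrite dec-true (InL? m (a ∷ cs)) inL = refl

cost-¬InL : ∀ {a : Fin n} cs → ¬ InL m (a ∷ cs) → cost m (a ∷ cs) ≡ length cs
cost-¬InL {m = m} {a} cs ¬inL rewrite dec-false (InL? m (a ∷ cs)) ¬inL = refl

GoodPair : ℕ → List (Fin n) × List (Fin n) → Set
GoodPair m (Ci , Cj) = InL m Ci × InL m Cj × PairCond m Ci Cj

pairLength : List (Fin n) × List (Fin n) → ℕ
pairLength (Ci , Cj) = length Ci + length Cj

module _ {σ : S n} where

  cycle-factorisation : n ≤ 2 * m + 1 → ∀ {C} → IsCycleOf σ C → Unique C → Factorisation σ m C (cost m C)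
  cycle-factorisation {m = m} n≤2m+1 {a ∷ cs} cycle u with InL? m (a ∷ cs)
  ... | yes inL = subst (Factorisation σ m _) (sym (cost-InL cs inL))
    (outer-centre-factorisation cs cycle u (near-all⇒∉InL near inL) (All.tabulate λ {x} _ → near x))
    where near = midpoint-near n≤2m+1 (InL⇒m<n inL)
  ... | no ¬inL with ¬InL⇒centre ¬inL
  ...   | c , c∈C , near = subst (Factorisation σ m _) (sym (cost-¬InL cs ¬inL))
    (centre-factorisation cs cycle u c∈C near)

  cycles-factorisation : n ≤ 2 * m + 1 → ∀ Cs → All (IsCycleOf σ) Cs → Unique (concat Cs) →
                         Factorisation σ m (concat Cs) (sum (map (cost m) Cs))
  cycles-factorisation n≤2m+1 []       []               _ = Factorisation-[]
  cycles-factorisation n≤2m+1 (C ∷ Cs) (cycle ∷ cycles) u with Unique-++⁻ C u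
  ... | uC , uCs , disj = Factorisation-++ disj (cycle-factorisation n≤2m+1 cycle uC)
                                                (cycles-factorisation n≤2m+1 Cs cycles uCs)

  pairs-factorisation : ∀ qs → All (IsCycleOf σ) (flatten qs) → All (GoodPair m) qs →
                        Unique (concat (flatten qs)) →
                        Factorisation σ m (concat (flatten qs)) (sum (map pairLength qs))
  pairs-factorisation []                _                      _                    _ = Factorisation-[]
  pairs-factorisation ((Ci , Cj) ∷ qs) (cycleᵢ ∷ cycleⱼ ∷ cycles) ((_ , _ , cond) ∷ good) u
    with Unique-++⁻ (Ci ++ Cj) (subst Unique (sym (++-assoc Ci Cj _)) u)
  ... | uᵢⱼ , uqs , disj with Unique-++⁻ Ci uᵢⱼ
  ...   | uᵢ , uⱼ , disjᵢⱼ = Factorisation-resp-↭ (↭-reflexive (++-assoc Ci Cj _))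
    (Factorisation-++ disj (pair-factorisation cycleᵢ cycleⱼ uᵢ uⱼ disjᵢⱼ cond)
                           (pairs-factorisation qs cycles good uqs))

pairLength-sum : ∀ {σ : S n} qs → All (IsCycleOf σ) (flatten qs) → All (GoodPair m) qs →
                 sum (map pairLength qs) + 2 * length qs ≡ sum (map (cost m) (flatten qs))
pairLength-sum []                              _                 _ = refl
pairLength-sum (([] , _) ∷ _)                  (() ∷ _)          _
pairLength-sum ((_ ∷ _ , []) ∷ _)              (_ ∷ () ∷ _)      _
pairLength-sum {m = m} ((a ∷ as , b ∷ bs) ∷ qs) (_ ∷ _ ∷ cycles) ((inLᵢ , inLⱼ , _) ∷ good) = begin
  (suc (length as) + suc (length bs) + sum (map pairLength qs)) + 2 * suc (length qs)
    ≡⟨ rearrange (length as) (length bs) (sum (map pairLength qs)) (length qs) ⟩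
  (2 + length as) + ((2 + length bs) + (sum (map pairLength qs) + 2 * length qs))
    ≡⟨ cong₂ _+_ (cost-InL as inLᵢ) (cong₂ _+_ (cost-InL bs inLⱼ) (sym (pairLength-sum qs cycles good))) ⟨
  cost m (a ∷ as) + (cost m (b ∷ bs) + sum (map (cost m) (flatten qs))) ∎
  where
  open ≡-Reasoning
  rearrange : ∀ p q s t → (suc p + suc q + s) + 2 * suc t ≡ (2 + p) + ((2 + q) + (s + 2 * t))
  rearrange = solve-∀

countL-∷ : ∀ (C : List (Fin n)) Cs → countL m (C ∷ Cs) ≡ (if does (InL? m C) then 1 else 0) + countL m Cs
countL-∷ {m = m} C Cs with does (InL? m C)
... | true  = refl
... | false = refl

cost-suc : ∀ (a : Fin n) as →
           suc (cost m (a ∷ as)) ≡ length (a ∷ as) + 2 * (if does (InL? m (a ∷ as)) then 1 else 0)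
cost-suc {m = m} a as = bonus (does (InL? m (a ∷ as))) (length as)
  where
  bonus : ∀ b k → suc ((if b then 2 else 0) + k) ≡ suc k + 2 * (if b then 1 else 0)
  bonus true  k = cong suc (+-comm 2 k)
  bonus false k = cong suc (sym (+-identityʳ k))

cost-sum : ∀ {σ : S n} Cs → All (IsCycleOf σ) Cs →
           sum (map (cost m) Cs) + length Cs ≡ length (concat Cs) + 2 * countL m Cs
cost-sum []             []             = refl
cost-sum ([] ∷ _)       (() ∷ _)
cost-sum {m = m} ((a ∷ as) ∷ Cs) (_ ∷ cycles) = begin
  cost m C + sum (map (cost m) Cs) + suc (length Cs)
    ≡⟨ rearrange (cost m C) _ _ ⟩
  suc (cost m C) + (sum (map (cost m) Cs) + length Cs)
    ≡⟨ cong₂ _+_ (cost-suc a as) (cost-sum Cs cycles) ⟩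
  (length C + 2 * [C∈L]) + (length (concat Cs) + 2 * countL m Cs)
    ≡⟨ regroup (length C) [C∈L] (length (concat Cs)) (countL m Cs) ⟩
  (length C + length (concat Cs)) + 2 * ([C∈L] + countL m Cs)
    ≡⟨ cong₂ (λ l k → l + 2 * k) (sym (length-++ C)) (sym (countL-∷ C Cs)) ⟩
  length (C ++ concat Cs) + 2 * countL m (C ∷ Cs) ∎
  where
  open ≡-Reasoning
  C = a ∷ as
  [C∈L] = if does (InL? m C) then 1 else 0
  rearrange : ∀ c s r → c + s + suc r ≡ suc c + (s + r)
  rearrange = solve-∀
  regroup : ∀ l i L k → (l + 2 * i) + (L + 2 * k) ≡ (l + L) + 2 * (i + k)
  regroup = solve-∀

budget-bound : ∀ {w t r N s} → w + 2 * t + r ≡ N + 2 * s → w ≤ (N ∸ r) + 2 * s ∸ 2 * t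
budget-bound {w} {t} {r} {N} {s} eq = m+n≤o⇒m≤o∸n w (begin
  w + 2 * t           ≡⟨ m+n∸n≡m (w + 2 * t) r ⟨
  w + 2 * t + r ∸ r   ≡⟨ cong (_∸ r) eq ⟩
  N + 2 * s ∸ r       ≤⟨ m≤n+o⇒m∸n≤o (N + 2 * s) r (begin
    N + 2 * s             ≤⟨ +-monoˡ-≤ (2 * s) (m≤n+m∸n N r) ⟩
    r + (N ∸ r) + 2 * s   ≡⟨ +-assoc r (N ∸ r) (2 * s) ⟩
    r + (N ∸ r + 2 * s)   ∎) ⟩
  N ∸ r + 2 * s       ∎)
  where open ≤-Reasoning

partition-cost : ∀ {σ : S n} {cs} qs rs → flatten qs ++ rs ↭ cs → All (IsCycleOf σ) cs →
                 All (GoodPair m) qs →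
                 sum (map pairLength qs) + sum (map (cost m) rs) + 2 * length qs + length cs ≡
                 length (concat cs) + 2 * countL m cs
partition-cost {m = m} {cs = cs} qs rs split cycles good = begin
  sum (map pairLength qs) + Σcost rs + 2 * length qs + length cs
    ≡⟨ cong (_+ length cs) (swap-middle (sum (map pairLength qs)) (Σcost rs) (2 * length qs)) ⟩
  sum (map pairLength qs) + 2 * length qs + Σcost rs + length cs
    ≡⟨ cong (λ k → k + Σcost rs + length cs) (pairLength-sum qs (proj₁ (All-++⁻ (flatten qs) cycles′)) good) ⟩
  Σcost (flatten qs) + Σcost rs + length cs
    ≡⟨ cong (_+ length cs) (trans (cong sum (map-++ (cost m) (flatten qs) rs))
                                  (sum-++ (map (cost m) (flatten qs)) _)) ⟨
  Σcost (flatten qs ++ rs) + length cs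
    ≡⟨ cong (_+ length cs) (sum-↭ (map-↭ (cost m) split)) ⟩
  Σcost cs + length cs
    ≡⟨ cost-sum cs cycles ⟩
  length (concat cs) + 2 * countL m cs ∎
  where
  open ≡-Reasoning
  cycles′ = All-resp-↭ (↭-sym split) cycles
  Σcost : List (List (Fin _)) → ℕ
  Σcost Cs = sum (map (cost m) Cs)
  swap-middle : ∀ a b c → a + b + c ≡ a + c + b
  swap-middle = solve-∀

partition-bound : n ≤ 2 * m + 1 → (σ : S n) (cs : List (List (Fin n))) → IsCycleDecomposition σ cs →
                  ∀ qs rs → flatten qs ++ rs ↭ cs → All (GoodPair m) qs →
                  d≤ σ m ((n ∸ length cs) + 2 * countL m cs ∸ 2 * length qs)
partition-bound {n} {m} n≤2m+1 σ cs (cycles , cs↭) qs rs split good =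
  Factorisation⇒d≤ covers
    (Factorisation-++ (proj₂ (proj₂ unique))
      (pairs-factorisation qs (proj₁ cycles′) good (proj₁ unique))
      (cycles-factorisation n≤2m+1 rs (proj₂ cycles′) (proj₁ (proj₂ unique))))
    (budget-bound {t = length qs} {N = n} {s = countL m cs}
      (trans (partition-cost qs rs split cycles good)
             (cong (_+ 2 * countL m cs) (trans (↭-length cs↭) (length-tabulate {n = n} (λ i → i))))))
  where
  support↭ : concat (flatten qs) ++ concat rs ↭ allFin n
  support↭ = ↭-trans (↭-reflexive (concat-++ (flatten qs) rs)) (↭-trans (concat-↭ split) cs↭)
  covers : ∀ x → x ∈ concat (flatten qs) ++ concat rs
  covers x = ∈-resp-↭ (↭-sym support↭) (∈-allFin x)
  unique = Unique-++⁻ (concat (flatten qs)) (Unique-resp-↭ (↭-sym support↭) (allFin⁺ n))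
  cycles′ = All-++⁻ (flatten qs) (All-resp-↭ (↭-sym split) cycles)

pairs-complement : ∀ (cs : List A) (ps : List (Fin (length cs) × Fin (length cs))) → Unique (flatten ps) →
                   ∃[ rs ] flatten (map (×-map (lookup cs) (lookup cs)) ps) ++ rs ↭ cs
pairs-complement cs ps u with ∃-↭-complement u (λ {i} _ → ∈-allFin i)
... | R , ps++R↭ = map (lookup cs) R , (begin
  flatten (map (×-map (lookup cs) (lookup cs)) ps) ++ map (lookup cs) R
    ≡⟨ cong (_++ map (lookup cs) R) (flatten-map (lookup cs) ps) ⟨
  map (lookup cs) (flatten ps) ++ map (lookup cs) R
    ≡⟨ map-++ (lookup cs) (flatten ps) R ⟨
  map (lookup cs) (flatten ps ++ R)
    ↭⟨ map-↭ (lookup cs) ps++R↭ ⟩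
  map (lookup cs) (allFin (length cs))
    ≡⟨ trans (map-tabulate (λ i → i) (lookup cs)) (tabulate-lookup cs) ⟩
  cs ∎)
  where open PermutationReasoning

lemma2p5 : (n m : ℕ) → 1 ≤ m → 5 ≤ n → n ≤ 2 * m + 1 →
    (σ : S n) (cs : List (List (Fin n))) → IsCycleDecomposition σ cs →
    (ps : List (Fin (length cs) × Fin (length cs))) → GoodPairs m cs ps →
    d≤ σ m ((n ∸ length cs) + 2 * countL m cs ∸ 2 * length ps)
lemma2p5 n m _ _ n≤2m+1 σ cs decomposition ps (good , unique) with pairs-complement cs ps unique
... | rs , split = subst (λ t → d≤ σ m ((n ∸ length cs) + 2 * countL m cs ∸ 2 * t)) (length-map _ ps)
  (partition-bound n≤2m+1 σ cs decomposition _ rs split (All-map⁺ good))
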